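{- For all positive integers $m,n$, $$\sum_{k=1}^n (-1)^{k-1}\binom{2n}{n-k} k^{1+2m} = \sum_{\ell=0}^m (-1)^\ell\, \langle 2n\rangle_{2\ell}\binom{2n-2\ell-2}{n-\ell-1}\sigma_{m,\ell}(n).$$
   Context: Falling factorial: $\langle x\rangle_0=1$ and $\langle x\rangle_j = x(x-1)\cdots(x-j+1)$ for positive integers $j$. Binomial coefficients: $\binom{x}{j}=\langle x\rangle_j/j!$ for integers $j\ge 0$ and $\binom{x}{j}=0$ for integers $j<0$. For nonnegative integers $\ell\le m$ and an indeterminate $y$, $\sigma_{m,\ell}(y)$ denotes the coefficient of $T^{m-\ell}$ in the formal power series $\prod_{j=0}^{\ell} \frac{1}{1-T(y-j)^2}$; equivalently $\sigma_{m,\ell}(y)=\sum_{0\le k_1\le\cdots\le k_{m-\ell}\le \ell}\prod_{i=1}^{m-\ell}(y-k_i)^2$. -}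

module Defs where

open import Data.Nat as ℕ using (ℕ; zero; suc; _!)
open import Data.Nat.Properties using (_!≢0)
open import Data.Integer using (ℤ; +_; -[1+_]; _+_; _*_; _-_; -_; _^_; _/ℕ_)


-- Σ_{i=a}^{b} f i  over naturals (empty sum = 0 if b < a)
sumFromTo : ℕ → ℕ → (ℕ → ℤ) → ℤ
sumFromTo a b f = go (suc b ℕ.∸ a)
  where
  go : ℕ → ℤ
  go zero = + 0
  go (suc r) = f (a ℕ.+ r) + go r

falling : ℤ → ℕ → ℤ
falling x zero = + 1
falling x (suc j) = falling x j * (x - + j)

sgn : ℕ → ℤ
sgn k = (- + 1) ^ k

-- binomial coefficient C(x, j) for integers x, j:
-- ⟨x⟩_j / j! if j ≥ 0 (this division is exact), and 0 if j < 0.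
binom : ℤ → ℤ → ℤ
binom x (+ j) = (falling x j /ℕ (j !)) {{j !≢0}}
binom x -[1+ _ ] = + 0

-- hsum y r u = Σ_{0 ≤ k_1 ≤ ... ≤ k_r ≤ u} Π_{i=1}^{r} (y - k_i)^2
hsum : ℤ → ℕ → ℕ → ℤ
hsum y zero u = + 1
hsum y (suc r) u = sumFromTo 0 u (λ k → ((y - + k) ^ 2) * hsum y r k)

-- σ_{m,ℓ}(y) = Σ_{0 ≤ k_1 ≤ ... ≤ k_{m-ℓ} ≤ ℓ} Π (y - k_i)^2   (for ℓ ≤ m)
σ : ℕ → ℕ → ℤ → ℤ
σ m ℓ y = hsum y (m ℕ.∸ ℓ) ℓ

-- Newton interpolation at the nodes (n - j)², j = 0, 1, 2, …, gives
-- k^{2m} = Σ_{ℓ ≤ m} σ_{m,ℓ}(n) Π_{j<ℓ} (k² - (n - j)²), because σ_{m,ℓ}(n) is the complete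
-- homogeneous polynomial of degree m - ℓ in the first ℓ + 1 nodes. After exchanging the sums it
-- remains to evaluate Σ_k (-1)^{k-1} k C(2n, n-k) Π_{j<ℓ} (k² - (n - j)²). As
-- C(2N+2, N+1-k) (k² - (N+1)²) = -(2N+2)(2N+1) C(2N, N-k), the product collapses to
-- (-1)^ℓ ⟨2n⟩_{2ℓ} C(2n-2ℓ, n-ℓ-k), and Σ_k (-1)^{k-1} k C(2M+2, M+1-k) telescopes to C(2M, M)
-- since k C(2M+2, M+1-k) = (M+1) (C(2M, M+1-k) - C(2M, M-1-k)). For ℓ ≥ n every k ∈ [1, n]
-- is a root of the product.

module Submission where

open import Defs
open import Data.Nat as ℕ using (ℕ; zero; suc; _!; z≤n; s≤s)
import Data.Nat.Properties as ℕ
import Data.Nat.DivMod as ℕ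
open import Data.Integer as ℤ using (ℤ; +_; -[1+_]; _+_; _*_; _-_; -_; _^_)
open import Data.Integer.Properties
open import Data.Integer.Tactic.RingSolver using (solve-∀)
open import Algebra.Properties.CommutativeSemigroup +-commutativeSemigroup
  using (interchange; x∙yz≈y∙xz)
open import Data.Sum using (inj₁; inj₂)
open import Relation.Nullary using (yes; no)
import Data.Nat.Combinatorics as ℕC
open import Relation.Binary.PropositionalEquality
open ≡-Reasoning

sum-cong : ∀ m {f g : ℕ → ℤ} → (∀ i → i ℕ.≤ m → f i ≡ g i) →
  sumFromTo 0 m f ≡ sumFromTo 0 m g
sum-cong zero f≗g = cong (_+ + 0) (f≗g 0 z≤n)
sum-cong (suc m) f≗g =
  cong₂ _+_ (f≗g (suc m) ℕ.≤-refl) (sum-cong m (λ i i≤m → f≗g i (ℕ.m≤n⇒m≤1+n i≤m)))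

sum-vanishes : ∀ m {f : ℕ → ℤ} → (∀ i → i ℕ.≤ m → f i ≡ + 0) → sumFromTo 0 m f ≡ + 0
sum-vanishes zero f≡0 = cong (_+ + 0) (f≡0 0 z≤n)
sum-vanishes (suc m) f≡0 =
  cong₂ _+_ (f≡0 (suc m) ℕ.≤-refl) (sum-vanishes m (λ i i≤m → f≡0 i (ℕ.m≤n⇒m≤1+n i≤m)))

sum-distrib-+ : ∀ m (f g : ℕ → ℤ) →
  sumFromTo 0 m (λ i → f i + g i) ≡ sumFromTo 0 m f + sumFromTo 0 m g
sum-distrib-+ zero f g = interchange (f 0) (g 0) (+ 0) (+ 0)
sum-distrib-+ (suc m) f g = begin
  f (suc m) + g (suc m) + sumFromTo 0 m (λ i → f i + g i)
    ≡⟨ cong (λ s → f (suc m) + g (suc m) + s) (sum-distrib-+ m f g) ⟩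
  f (suc m) + g (suc m) + (sumFromTo 0 m f + sumFromTo 0 m g)
    ≡⟨ interchange (f (suc m)) (g (suc m)) _ _ ⟩
  f (suc m) + sumFromTo 0 m f + (g (suc m) + sumFromTo 0 m g) ∎

*-distribˡ-sum : ∀ m c (f : ℕ → ℤ) → c * sumFromTo 0 m f ≡ sumFromTo 0 m (λ i → c * f i)
*-distribˡ-sum zero c f = trans (cong (c *_) (+-identityʳ (f 0))) (sym (+-identityʳ (c * f 0)))
*-distribˡ-sum (suc m) c f =
  trans (*-distribˡ-+ c (f (suc m)) _) (cong (λ s → c * f (suc m) + s) (*-distribˡ-sum m c f))

sum-comm : ∀ n m (F : ℕ → ℕ → ℤ) →
  sumFromTo 0 n (λ k → sumFromTo 0 m (F k)) ≡ sumFromTo 0 m (λ l → sumFromTo 0 n (λ k → F k l))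
sum-comm zero m F = trans (+-identityʳ _) (sum-cong m (λ l _ → sym (+-identityʳ (F 0 l))))
sum-comm (suc n) m F =
  trans (cong (λ s → sumFromTo 0 m (F (suc n)) + s) (sum-comm n m F))
        (sym (sum-distrib-+ m (F (suc n)) _))

sum-head : ∀ m (f : ℕ → ℤ) → sumFromTo 0 (suc m) f ≡ f 0 + sumFromTo 0 m (λ i → f (suc i))
sum-head zero f = x∙yz≈y∙xz (f 1) (f 0) (+ 0)
sum-head (suc m) f =
  trans (cong (λ s → f (suc (suc m)) + s) (sum-head m f)) (x∙yz≈y∙xz (f (suc (suc m))) (f 0) _)

sum-from-1 : ∀ m (f : ℕ → ℤ) → f 0 ≡ + 0 → sumFromTo 1 m f ≡ sumFromTo 0 m f
sum-from-1 zero f f0≡0 = sym (trans (+-identityʳ (f 0)) f0≡0)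
sum-from-1 (suc m) f f0≡0 = cong (λ s → f (suc m) + s) (sum-from-1 m f f0≡0)

sum-telescope₂ : ∀ K (u : ℕ → ℤ) →
  sumFromTo 0 K (λ k → u k - u (suc (suc k))) ≡ u 0 + u 1 - u (suc K) - u (suc (suc K))
sum-telescope₂ zero u = base (u 0) (u 1) (u 2)
  where
  base : ∀ u₀ u₁ u₂ → u₀ - u₂ + + 0 ≡ u₀ + u₁ - u₁ - u₂
  base = solve-∀
sum-telescope₂ (suc K) u =
  trans (cong (λ s → u (suc K) - u (suc (suc (suc K))) + s) (sum-telescope₂ K u))
        (step (u 0) (u 1) (u (suc K)) _ _)
  where
  step : ∀ u₀ u₁ v w z → v - z + (u₀ + u₁ - v - w) ≡ u₀ + u₁ - w - z
  step = solve-∀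

module Newton (c : ℕ → ℤ) where

  basis : ℕ → ℤ → ℤ
  basis zero x = + 1
  basis (suc l) x = basis l x * (x - c l)

  -- coeff m l = h_{m-l}(c 0, …, c l), the complete homogeneous polynomial,
  -- extended by 0 to l > m so that no truncated subtraction is needed.
  coeff : ℕ → ℕ → ℤ
  coeff zero zero = + 1
  coeff zero (suc l) = + 0
  coeff (suc m) zero = c 0 * coeff m 0
  coeff (suc m) (suc l) = c (suc l) * coeff m (suc l) + coeff m l

  coeff-vanishes : ∀ {m l} → m ℕ.< l → coeff m l ≡ + 0
  coeff-vanishes {zero} {suc l} _ = refl
  coeff-vanishes {suc m} {suc l} (s≤s m<l) =
    trans (cong₂ (λ p q → c (suc l) * p + q)
                 (coeff-vanishes (ℕ.m<n⇒m<1+n m<l)) (coeff-vanishes m<l))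
          (cong (_+ + 0) (*-zeroʳ (c (suc l))))

  coeff-diag : ∀ m → coeff m m ≡ + 1
  coeff-diag zero = refl
  coeff-diag (suc m) =
    trans (cong₂ (λ p q → c (suc m) * p + q) (coeff-vanishes (ℕ.n<1+n m)) (coeff-diag m))
          (cong (_+ + 1) (*-zeroʳ (c (suc m))))

  basis-node : ∀ {j l} → j ℕ.< l → basis l (c j) ≡ + 0
  basis-node {j} {suc l} j<1+l with ℕ.m<1+n⇒m<n∨m≡n j<1+l
  ... | inj₁ j<l = cong (_* (c j - c l)) (basis-node j<l)
  ... | inj₂ refl = trans (cong (basis l (c j) *_) (+-inverseʳ (c j))) (*-zeroʳ (basis l (c j)))

  power-expansion : ∀ x m → x ^ m ≡ sumFromTo 0 m (λ l → coeff m l * basis l x)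
  power-expansion x zero = refl
  power-expansion x (suc m) = begin
    x * x ^ m
      ≡⟨ cong (x *_) (power-expansion x m) ⟩
    x * sumFromTo 0 m (λ l → coeff m l * basis l x)
      ≡⟨ *-distribˡ-sum m x _ ⟩
    sumFromTo 0 m (λ l → x * (coeff m l * basis l x))
      ≡⟨ sum-cong m (λ l _ → x*term l) ⟩
    sumFromTo 0 m (λ l → g l + h l)
      ≡⟨ sum-distrib-+ m g h ⟩
    sumFromTo 0 m g + sumFromTo 0 m h
      ≡⟨ cong (λ s → s + sumFromTo 0 m h) (sym Σg-extends) ⟩
    sumFromTo 0 (suc m) g + sumFromTo 0 m h
      ≡⟨ cong (λ s → s + sumFromTo 0 m h) (sum-head m g) ⟩
    g 0 + sumFromTo 0 m (λ l → g (suc l)) + sumFromTo 0 m h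
      ≡⟨ +-assoc (g 0) _ _ ⟩
    g 0 + (sumFromTo 0 m (λ l → g (suc l)) + sumFromTo 0 m h)
      ≡⟨ cong (λ s → g 0 + s) (sym (sum-distrib-+ m (λ l → g (suc l)) h)) ⟩
    g 0 + sumFromTo 0 m (λ l → g (suc l) + h l)
      ≡⟨ cong (λ s → g 0 + s) (sum-cong m (λ l _ → sym (term[l+1] l))) ⟩
    g 0 + sumFromTo 0 m (λ l → coeff (suc m) (suc l) * basis (suc l) x)
      ≡⟨ sym (sum-head m (λ l → coeff (suc m) l * basis l x)) ⟩
    sumFromTo 0 (suc m) (λ l → coeff (suc m) l * basis l x) ∎
    where
    g h : ℕ → ℤ
    g l = c l * coeff m l * basis l x
    h l = coeff m l * basis (suc l) x
    x*term : ∀ l → x * (coeff m l * basis l x) ≡ g l + h l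
    x*term l = ring x (c l) (coeff m l) (basis l x)
      where
      ring : ∀ x c a b → x * (a * b) ≡ c * a * b + a * (b * (x - c))
      ring = solve-∀
    term[l+1] : ∀ l → coeff (suc m) (suc l) * basis (suc l) x ≡ g (suc l) + h l
    term[l+1] l = *-distribʳ-+ (basis (suc l) x) (c (suc l) * coeff m (suc l)) (coeff m l)
    Σg-extends : sumFromTo 0 (suc m) g ≡ sumFromTo 0 m g
    Σg-extends = begin
      c (suc m) * coeff m (suc m) * basis (suc m) x + sumFromTo 0 m g
        ≡⟨ cong (λ a → c (suc m) * a * basis (suc m) x + sumFromTo 0 m g)
                (coeff-vanishes (ℕ.n<1+n m)) ⟩
      c (suc m) * + 0 * basis (suc m) x + sumFromTo 0 m g
        ≡⟨ cong (λ a → a * basis (suc m) x + sumFromTo 0 m g) (*-zeroʳ (c (suc m))) ⟩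
      + 0 + sumFromTo 0 m g
        ≡⟨ +-identityˡ (sumFromTo 0 m g) ⟩
      sumFromTo 0 m g ∎

node : ℤ → ℕ → ℤ
node y j = (y - + j) ^ 2

hsum≡coeff : ∀ y r u → hsum y r u ≡ Newton.coeff (node y) (r ℕ.+ u) u
hsum≡coeff y zero u = sym (Newton.coeff-diag (node y) u)
hsum≡coeff y (suc r) zero = trans (+-identityʳ _) (cong (node y 0 *_) (hsum≡coeff y r 0))
hsum≡coeff y (suc r) (suc u) =
  cong₂ (λ p q → node y (suc u) * p + q) (hsum≡coeff y r (suc u))
        (trans (hsum≡coeff y (suc r) u)
               (cong (λ w → Newton.coeff (node y) w u) (sym (ℕ.+-suc r u))))

σ≡coeff : ∀ {m l} y → l ℕ.≤ m → σ m l y ≡ Newton.coeff (node y) m l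
σ≡coeff {m} {l} y l≤m =
  trans (hsum≡coeff y (m ℕ.∸ l) l) (cong (λ w → Newton.coeff (node y) w l) (ℕ.m∸n+n≡m l≤m))

+[m+n]-+m≡+n : ∀ m n → + (m ℕ.+ n) - + m ≡ + n
+[m+n]-+m≡+n m n =
  trans (m-n≡m⊖n (m ℕ.+ n) m) (trans (⊖-≥ (ℕ.m≤m+n m n)) (cong +_ (ℕ.m+n∸m≡n m n)))

m<n⇒+m-+n≡-[1+n∸[1+m]] : ∀ {m n} → m ℕ.< n → + m - + n ≡ -[1+ n ℕ.∸ suc m ]
m<n⇒+m-+n≡-[1+n∸[1+m]] {zero} {suc n} _ = refl
m<n⇒+m-+n≡-[1+n∸[1+m]] {suc m} {suc n} (s≤s m<n) =
  trans ([1+m]⊖[1+n]≡m⊖n m n) (trans (sym (m-n≡m⊖n m n)) (m<n⇒+m-+n≡-[1+n∸[1+m]] m<n))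

2[l+1+N]≡2l+2+2N : ∀ l N → 2 ℕ.* (l ℕ.+ suc N) ≡ 2 ℕ.* l ℕ.+ suc (suc (2 ℕ.* N))
2[l+1+N]≡2l+2+2N l N = trans (ℕ.*-distribˡ-+ 2 l (suc N)) (cong (2 ℕ.* l ℕ.+_) (ℕ.*-suc 2 N))

-- Pascal's rule with an integer lower index, so that it also holds at the boundary.
C : ℕ → ℤ → ℤ
C zero (+ zero) = + 1
C zero (+ suc _) = + 0
C zero -[1+ _ ] = + 0
C (suc a) j = C a j + C a (j - + 1)

C-negative : ∀ a k → C a -[1+ k ] ≡ + 0
C-negative zero k = refl
C-negative (suc a) k = cong₂ _+_ (C-negative a k) (C-negative a (suc (k ℕ.+ 0)))

C[a,j]≡aCj : ∀ a j → C a (+ j) ≡ + (a ℕC.C j)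
C[a,j]≡aCj zero zero = refl
C[a,j]≡aCj zero (suc j) = refl
C[a,j]≡aCj (suc a) zero = cong₂ _+_ (C[a,j]≡aCj a 0) (C-negative a 0)
C[a,j]≡aCj (suc a) (suc j) = begin
  C a (+ suc j) + C a (+ j)               ≡⟨ cong₂ _+_ (C[a,j]≡aCj a (suc j)) (C[a,j]≡aCj a j) ⟩
  + (a ℕC.C suc j) + + (a ℕC.C j)         ≡⟨ sym (pos-+ (a ℕC.C suc j) (a ℕC.C j)) ⟩
  + (a ℕC.C suc j ℕ.+ a ℕC.C j)           ≡⟨ cong +_ (ℕ.+-comm (a ℕC.C suc j) (a ℕC.C j)) ⟩
  + (a ℕC.C j ℕ.+ a ℕC.C suc j)           ≡⟨ cong +_ (ℕC.nCk+nC[k+1]≡[n+1]C[k+1] a j) ⟩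
  + (suc a ℕC.C suc j)                    ∎

jC[a+1,j]≡[a+1]C[a,j-1] : ∀ a j → j * C (suc a) j ≡ + suc a * C a (j - + 1)
jC[a+1,j]≡[a+1]C[a,j-1] zero (+ zero) = refl
jC[a+1,j]≡[a+1]C[a,j-1] zero (+ suc zero) = refl
jC[a+1,j]≡[a+1]C[a,j-1] zero (+ suc (suc t)) = *-zeroʳ (+ suc (suc t))
jC[a+1,j]≡[a+1]C[a,j-1] zero -[1+ t ] = *-zeroʳ -[1+ t ]
jC[a+1,j]≡[a+1]C[a,j-1] (suc a) j = begin
  j * (C (suc a) j + C (suc a) (j - + 1))
    ≡⟨ split j (C (suc a) j) (C (suc a) (j - + 1)) ⟩
  j * C (suc a) j + (j - + 1) * C (suc a) (j - + 1) + C (suc a) (j - + 1)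
    ≡⟨ cong₂ (λ p q → p + q + C (suc a) (j - + 1))
             (jC[a+1,j]≡[a+1]C[a,j-1] a j) (jC[a+1,j]≡[a+1]C[a,j-1] a (j - + 1)) ⟩
  + suc a * C a (j - + 1) + + suc a * C a (j - + 1 - + 1) + (C a (j - + 1) + C a (j - + 1 - + 1))
    ≡⟨ collect (+ suc a) (C a (j - + 1)) (C a (j - + 1 - + 1)) ⟩
  + suc (suc a) * (C a (j - + 1) + C a (j - + 1 - + 1)) ∎
  where
  split : ∀ j x y → j * (x + y) ≡ j * x + (j - + 1) * y + y
  split = solve-∀
  collect : ∀ a x y → a * x + a * y + (x + y) ≡ (+ 1 + a) * (x + y)
  collect = solve-∀

[a+1-j]C[a+1,j]≡[a+1]C[a,j] : ∀ a j → (+ suc a - j) * C (suc a) j ≡ + suc a * C a j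
[a+1-j]C[a+1,j]≡[a+1]C[a,j] a j = begin
  (+ suc a - j) * (C a j + C a (j - + 1))
    ≡⟨ expand (+ suc a) j (C a j) (C a (j - + 1)) ⟩
  + suc a * C a j + (+ suc a * C a (j - + 1) - j * C (suc a) j)
    ≡⟨ cong (λ p → + suc a * C a j + (+ suc a * C a (j - + 1) - p)) (jC[a+1,j]≡[a+1]C[a,j-1] a j) ⟩
  + suc a * C a j + (+ suc a * C a (j - + 1) - + suc a * C a (j - + 1))
    ≡⟨ cong (λ s → + suc a * C a j + s) (+-inverseʳ (+ suc a * C a (j - + 1))) ⟩
  + suc a * C a j + + 0
    ≡⟨ +-identityʳ _ ⟩
  + suc a * C a j ∎
  where
  expand : ∀ A j x y → (A - j) * (x + y) ≡ A * x + (A * y - j * (x + y))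
  expand = solve-∀

[j+1]C[a,j+1]≡[a-j]C[a,j] : ∀ a j → ℤ.suc j * C a (ℤ.suc j) ≡ (+ a - j) * C a j
[j+1]C[a,j+1]≡[a-j]C[a,j] zero (+ zero) = refl
[j+1]C[a,j+1]≡[a-j]C[a,j] zero (+ suc t) = trans (*-zeroʳ (+ suc (suc t))) (sym (*-zeroʳ (- + suc t)))
[j+1]C[a,j+1]≡[a-j]C[a,j] zero -[1+ zero ] = refl
[j+1]C[a,j+1]≡[a-j]C[a,j] zero -[1+ suc t ] = trans (*-zeroʳ -[1+ t ]) (sym (*-zeroʳ (+ suc (suc t))))
[j+1]C[a,j+1]≡[a-j]C[a,j] (suc a) j = begin
  ℤ.suc j * C (suc a) (ℤ.suc j)  ≡⟨ jC[a+1,j]≡[a+1]C[a,j-1] a (ℤ.suc j) ⟩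
  + suc a * C a (ℤ.suc j - + 1)  ≡⟨ cong (λ i → + suc a * C a i) (suc-minus-1 j) ⟩
  + suc a * C a j                ≡⟨ sym ([a+1-j]C[a+1,j]≡[a+1]C[a,j] a j) ⟩
  (+ suc a - j) * C (suc a) j    ∎
  where
  suc-minus-1 : ∀ j → + 1 + j - + 1 ≡ j
  suc-minus-1 = solve-∀

falling≡C*! : ∀ a j → falling (+ a) j ≡ C a (+ j) * + (j !)
falling≡C*! a zero = sym (trans (*-identityʳ (C a (+ 0))) (C[a,j]≡aCj a 0))
falling≡C*! a (suc j) = begin
  falling (+ a) j * (+ a - + j)          ≡⟨ cong (_* (+ a - + j)) (falling≡C*! a j) ⟩
  C a (+ j) * + (j !) * (+ a - + j)      ≡⟨ rotate (C a (+ j)) (+ (j !)) (+ a - + j) ⟩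
  (+ a - + j) * C a (+ j) * + (j !)      ≡⟨ cong (_* + (j !)) (sym ([j+1]C[a,j+1]≡[a-j]C[a,j] a (+ j))) ⟩
  + suc j * C a (+ suc j) * + (j !)      ≡⟨ reassoc (+ suc j) (C a (+ suc j)) (+ (j !)) ⟩
  C a (+ suc j) * (+ suc j * + (j !))    ≡⟨ cong (C a (+ suc j) *_) (sym (pos-* (suc j) (j !))) ⟩
  C a (+ suc j) * + (suc j !)            ∎
  where
  rotate : ∀ x f d → x * f * d ≡ d * x * f
  rotate = solve-∀
  reassoc : ∀ s x f → s * x * f ≡ x * (s * f)
  reassoc = solve-∀

binom≡C : ∀ a j → binom (+ a) j ≡ C a j
binom≡C a (+ j) = begin
  binom (+ a) (+ j)                  ≡⟨ cong (ℤ._/ℕ j !) falling≡ℕ ⟩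
  + (((a ℕC.C j) ℕ.* j !) ℕ./ j !)   ≡⟨ cong +_ (ℕ.m*n/n≡m (a ℕC.C j) (j !)) ⟩
  + (a ℕC.C j)                       ≡⟨ sym (C[a,j]≡aCj a j) ⟩
  C a (+ j)                          ∎
  where
  instance
    j!≢0 : ℕ.NonZero (j !)
    j!≢0 = j ℕ.!≢0
  falling≡ℕ : falling (+ a) j ≡ + ((a ℕC.C j) ℕ.* j !)
  falling≡ℕ = trans (falling≡C*! a j)
                (trans (cong (_* + (j !)) (C[a,j]≡aCj a j)) (sym (pos-* (a ℕC.C j) (j !))))
binom≡C a -[1+ k ] = sym (C-negative a k)

C-below : ∀ a {m j} → m ℕ.< j → C a (+ m - + j) ≡ + 0
C-below a {m} {j} m<j = trans (cong (C a) (m<n⇒+m-+n≡-[1+n∸[1+m]] m<j)) (C-negative a (j ℕ.∸ suc m))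

j[a+2-j]C[a+2,j]≡[a+2][a+1]C[a,j-1] : ∀ a j →
  j * (+ suc (suc a) - j) * C (suc (suc a)) j ≡ + suc (suc a) * + suc a * C a (j - + 1)
j[a+2-j]C[a+2,j]≡[a+2][a+1]C[a,j-1] a j = begin
  j * (A - j) * C (suc (suc a)) j
    ≡⟨ swap j (A - j) (C (suc (suc a)) j) ⟩
  (A - j) * (j * C (suc (suc a)) j)
    ≡⟨ cong ((A - j) *_) (jC[a+1,j]≡[a+1]C[a,j-1] (suc a) j) ⟩
  (A - j) * (A * C (suc a) (j - + 1))
    ≡⟨ regroup (+ suc a) j (C (suc a) (j - + 1)) ⟩
  A * ((+ suc a - (j - + 1)) * C (suc a) (j - + 1))
    ≡⟨ cong (A *_) ([a+1-j]C[a+1,j]≡[a+1]C[a,j] a (j - + 1)) ⟩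
  A * (+ suc a * C a (j - + 1))
    ≡⟨ sym (*-assoc A (+ suc a) _) ⟩
  A * + suc a * C a (j - + 1) ∎
  where
  A : ℤ
  A = + suc (suc a)
  swap : ∀ j d x → j * d * x ≡ d * (j * x)
  swap = solve-∀
  regroup : ∀ b j x → (+ 1 + b - j) * ((+ 1 + b) * x) ≡ (+ 1 + b) * ((b - (j - + 1)) * x)
  regroup = solve-∀

[a+2-2j]C[a+2,j]≡[a+2][C[a,j]-C[a,j-2]] : ∀ a j →
  (+ suc (suc a) - (j + j)) * C (suc (suc a)) j ≡ + suc (suc a) * (C a j - C a (j - + 1 - + 1))
[a+2-2j]C[a+2,j]≡[a+2][C[a,j]-C[a,j-2]] a j = begin
  (A - (j + j)) * C (suc (suc a)) j
    ≡⟨ split A j (C (suc (suc a)) j) ⟩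
  (A - j) * C (suc (suc a)) j - j * C (suc (suc a)) j
    ≡⟨ cong₂ _-_ ([a+1-j]C[a+1,j]≡[a+1]C[a,j] (suc a) j) (jC[a+1,j]≡[a+1]C[a,j-1] (suc a) j) ⟩
  A * (C a j + C a (j - + 1)) - A * (C a (j - + 1) + C a (j - + 1 - + 1))
    ≡⟨ cancel A (C a j) (C a (j - + 1)) (C a (j - + 1 - + 1)) ⟩
  A * (C a j - C a (j - + 1 - + 1)) ∎
  where
  A : ℤ
  A = + suc (suc a)
  split : ∀ A j x → (A - (j + j)) * x ≡ (A - j) * x - j * x
  split = solve-∀
  cancel : ∀ A x y z → A * (x + y) - A * (y + z) ≡ A * (x - z)
  cancel = solve-∀

-- Twice this identity is the case a = 2M, j = M - k of the previous lemma.
[k+1]C[2M+2,M-k]≡[M+1][C[2M,M-k]-C[2M,M-k-2]] : ∀ M k →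
  + suc k * C (2 ℕ.* suc M) (+ suc M - + suc k)
    ≡ + suc M * (C (2 ℕ.* M) (+ M - + k) - C (2 ℕ.* M) (+ M - + suc (suc k)))
[k+1]C[2M+2,M-k]≡[M+1][C[2M,M-k]-C[2M,M-k-2]] M k = *-cancelˡ-≡ (+ 2) _ _ (begin
  + 2 * (+ suc k * C (2 ℕ.* suc M) (+ suc M - + suc k))
    ≡⟨ cong₂ (λ b i → + 2 * (+ suc k * C b i)) (ℕ.*-suc 2 M) (shift (+ M) (+ k)) ⟩
  + 2 * (+ suc k * C (suc (suc a)) j)
    ≡⟨ trans (sym (*-assoc (+ 2) (+ suc k) _)) (cong (_* C (suc (suc a)) j) (sym weight)) ⟩
  (+ suc (suc a) - (j + j)) * C (suc (suc a)) j
    ≡⟨ [a+2-2j]C[a+2,j]≡[a+2][C[a,j]-C[a,j-2]] a j ⟩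
  + suc (suc a) * (C a j - C a (j - + 1 - + 1))
    ≡⟨ cong₂ (λ A i → A * (C a j - C a i))
             (trans (cong +_ (sym (ℕ.*-suc 2 M))) (pos-* 2 (suc M))) (shift₂ (+ M) (+ k)) ⟩
  + 2 * + suc M * (C a j - C a (+ M - + suc (suc k)))
    ≡⟨ *-assoc (+ 2) (+ suc M) _ ⟩
  + 2 * (+ suc M * (C a j - C a (+ M - + suc (suc k)))) ∎)
  where
  a : ℕ
  a = 2 ℕ.* M
  j : ℤ
  j = + M - + k
  shift : ∀ m k → + 1 + m - (+ 1 + k) ≡ m - k
  shift = solve-∀
  shift₂ : ∀ m k → m - k - + 1 - + 1 ≡ m - (+ 1 + (+ 1 + k))
  shift₂ = solve-∀
  weight : + suc (suc a) - (j + j) ≡ + 2 * + suc k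
  weight = trans (cong (λ b → + 1 + (+ 1 + b) - (j + j)) (pos-* 2 M)) (ring (+ M) (+ k))
    where
    ring : ∀ m k → + 1 + (+ 1 + + 2 * m) - ((m - k) + (m - k)) ≡ + 2 * (+ 1 + k)
    ring = solve-∀

[M+1]C[2M,M-1]≡MC[2M,M] : ∀ M → + suc M * C (2 ℕ.* M) (+ M - + 1) ≡ + M * C (2 ℕ.* M) (+ M)
[M+1]C[2M,M-1]≡MC[2M,M] M = begin
  + suc M * C (2 ℕ.* M) (+ M - + 1)
    ≡⟨ cong (_* C (2 ℕ.* M) (+ M - + 1)) (sym weight) ⟩
  (+ (2 ℕ.* M) - (+ M - + 1)) * C (2 ℕ.* M) (+ M - + 1)
    ≡⟨ sym ([j+1]C[a,j+1]≡[a-j]C[a,j] (2 ℕ.* M) (+ M - + 1)) ⟩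
  ℤ.suc (+ M - + 1) * C (2 ℕ.* M) (ℤ.suc (+ M - + 1))
    ≡⟨ cong (λ i → i * C (2 ℕ.* M) i) (unshift (+ M)) ⟩
  + M * C (2 ℕ.* M) (+ M) ∎
  where
  unshift : ∀ m → + 1 + (m - + 1) ≡ m
  unshift = solve-∀
  weight : + (2 ℕ.* M) - (+ M - + 1) ≡ + suc M
  weight = trans (cong (λ b → b - (+ M - + 1)) (pos-* 2 M)) (ring (+ M))
    where
    ring : ∀ m → + 2 * m - (m - + 1) ≡ + 1 + m
    ring = solve-∀

alternating-sum-kC : ∀ M K → M ℕ.< K →
  sumFromTo 0 K (λ k → sgn (k ℕ.∸ 1) * + k * C (2 ℕ.* suc M) (+ suc M - + k)) ≡ C (2 ℕ.* M) (+ M)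
alternating-sum-kC M (suc K) (s≤s M≤K) = begin
  sumFromTo 0 (suc K) t
    ≡⟨ trans (sum-head K t) (+-identityˡ _) ⟩
  sumFromTo 0 K (λ j → t (suc j))
    ≡⟨ sum-cong K (λ j _ → t[j+1] j) ⟩
  sumFromTo 0 K (λ j → + suc M * (u j - u (suc (suc j))))
    ≡⟨ sym (*-distribˡ-sum K (+ suc M) (λ j → u j - u (suc (suc j)))) ⟩
  + suc M * sumFromTo 0 K (λ j → u j - u (suc (suc j)))
    ≡⟨ cong (+ suc M *_) (sum-telescope₂ K u) ⟩
  + suc M * (u 0 + u 1 - u (suc K) - u (suc (suc K)))
    ≡⟨ cong₂ (λ p q → + suc M * (u 0 + u 1 - p - q))
             (u-vanishes (s≤s M≤K)) (u-vanishes (s≤s (ℕ.m≤n⇒m≤1+n M≤K))) ⟩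
  + suc M * (u 0 + u 1 - + 0 - + 0)
    ≡⟨ expand (+ M) (C (2 ℕ.* M) (+ M - + 0)) (C (2 ℕ.* M) (+ M - + 1)) ⟩
  + suc M * C (2 ℕ.* M) (+ M - + 0) - + suc M * C (2 ℕ.* M) (+ M - + 1)
    ≡⟨ cong₂ (λ i p → + suc M * C (2 ℕ.* M) i - p) (+-identityʳ (+ M)) ([M+1]C[2M,M-1]≡MC[2M,M] M) ⟩
  + suc M * C (2 ℕ.* M) (+ M) - + M * C (2 ℕ.* M) (+ M)
    ≡⟨ collapse (+ M) (C (2 ℕ.* M) (+ M)) ⟩
  C (2 ℕ.* M) (+ M) ∎
  where
  t u : ℕ → ℤ
  t k = sgn (k ℕ.∸ 1) * + k * C (2 ℕ.* suc M) (+ suc M - + k)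
  u j = sgn j * C (2 ℕ.* M) (+ M - + j)
  t[j+1] : ∀ j → t (suc j) ≡ + suc M * (u j - u (suc (suc j)))
  t[j+1] j = begin
    sgn j * + suc j * C (2 ℕ.* suc M) (+ suc M - + suc j)
      ≡⟨ *-assoc (sgn j) (+ suc j) _ ⟩
    sgn j * (+ suc j * C (2 ℕ.* suc M) (+ suc M - + suc j))
      ≡⟨ cong (sgn j *_) ([k+1]C[2M+2,M-k]≡[M+1][C[2M,M-k]-C[2M,M-k-2]] M j) ⟩
    sgn j * (+ suc M * (C (2 ℕ.* M) (+ M - + j) - C (2 ℕ.* M) (+ M - + suc (suc j))))
      ≡⟨ signs (sgn j) (+ suc M) (C (2 ℕ.* M) (+ M - + j)) (C (2 ℕ.* M) (+ M - + suc (suc j))) ⟩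
    + suc M * (u j - u (suc (suc j))) ∎
    where
    signs : ∀ s m x y → s * (m * (x - y)) ≡ m * (s * x - - + 1 * (- + 1 * s) * y)
    signs = solve-∀
  u-vanishes : ∀ {j} → M ℕ.< j → u j ≡ + 0
  u-vanishes {j} M<j = trans (cong (sgn j *_) (C-below (2 ℕ.* M) M<j)) (*-zeroʳ (sgn j))
  expand : ∀ m x y →
    (+ 1 + m) * (+ 1 * x + - + 1 * + 1 * y - + 0 - + 0) ≡ (+ 1 + m) * x - (+ 1 + m) * y
  expand = solve-∀
  collapse : ∀ m x → (+ 1 + m) * x - m * x ≡ x
  collapse = solve-∀

C[2N+2,N+1-k][k²-[N+1]²]≡-[2N+2][2N+1]C[2N,N-k] : ∀ N k →
  C (2 ℕ.* suc N) (+ suc N - k) * (k ^ 2 - (+ suc N) ^ 2)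
    ≡ - (+ suc (suc (2 ℕ.* N)) * + suc (2 ℕ.* N)) * C (2 ℕ.* N) (+ N - k)
C[2N+2,N+1-k][k²-[N+1]²]≡-[2N+2][2N+1]C[2N,N-k] N k = begin
  C (2 ℕ.* suc N) j * (k ^ 2 - (+ suc N) ^ 2)
    ≡⟨ cong₂ (λ b e → C b j * e) (ℕ.*-suc 2 N) difference-of-squares ⟩
  C (suc (suc a)) j * - (j * (+ suc (suc a) - j))
    ≡⟨ neg-comm (C (suc (suc a)) j) (j * (+ suc (suc a) - j)) ⟩
  - (j * (+ suc (suc a) - j) * C (suc (suc a)) j)
    ≡⟨ cong -_ (j[a+2-j]C[a+2,j]≡[a+2][a+1]C[a,j-1] a j) ⟩
  - (+ suc (suc a) * + suc a * C a (j - + 1))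
    ≡⟨ cong (λ i → - (+ suc (suc a) * + suc a * C a i)) (unshift (+ N) k) ⟩
  - (+ suc (suc a) * + suc a * C a (+ N - k))
    ≡⟨ neg-distribˡ-* (+ suc (suc a) * + suc a) (C a (+ N - k)) ⟩
  - (+ suc (suc a) * + suc a) * C a (+ N - k) ∎
  where
  a : ℕ
  a = 2 ℕ.* N
  j : ℤ
  j = + suc N - k
  difference-of-squares : k ^ 2 - (+ suc N) ^ 2 ≡ - (j * (+ suc (suc a) - j))
  difference-of-squares =
    trans (ring (+ N) k) (cong (λ b → - (j * (+ 1 + (+ 1 + b) - j))) (sym (pos-* 2 N)))
    where
    ring : ∀ n k → k * (k * + 1) - (+ 1 + n) * ((+ 1 + n) * + 1)
                   ≡ - ((+ 1 + n - k) * (+ 1 + (+ 1 + + 2 * n) - (+ 1 + n - k)))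
    ring = solve-∀
  neg-comm : ∀ x y → x * - y ≡ - (y * x)
  neg-comm = solve-∀
  unshift : ∀ n k → + 1 + n - k - + 1 ≡ n - k
  unshift = solve-∀

C[2n,n-k]*basis≡sgn*falling*C[2N,N-k] : ∀ l N {n} k → n ≡ l ℕ.+ N →
  C (2 ℕ.* n) (+ n - k) * Newton.basis (node (+ n)) l (k ^ 2)
    ≡ sgn l * falling (+ (2 ℕ.* n)) (2 ℕ.* l) * C (2 ℕ.* N) (+ N - k)
C[2n,n-k]*basis≡sgn*falling*C[2N,N-k] zero N k refl = trans (*-identityʳ _) (sym (*-identityˡ _))
C[2n,n-k]*basis≡sgn*falling*C[2N,N-k] (suc l) N {n} k n≡1+l+N = begin
  C (2 ℕ.* n) (+ n - k) * (P * (k ^ 2 - (+ n - + l) ^ 2))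
    ≡⟨ sym (*-assoc (C (2 ℕ.* n) (+ n - k)) P _) ⟩
  C (2 ℕ.* n) (+ n - k) * P * (k ^ 2 - (+ n - + l) ^ 2)
    ≡⟨ cong₂ _*_ (C[2n,n-k]*basis≡sgn*falling*C[2N,N-k] l (suc N) k n≡l+1+N)
                 (cong (λ d → k ^ 2 - d ^ 2) n-l≡1+N) ⟩
  sgn l * F * C (2 ℕ.* suc N) (+ suc N - k) * (k ^ 2 - (+ suc N) ^ 2)
    ≡⟨ *-assoc (sgn l * F) _ _ ⟩
  sgn l * F * (C (2 ℕ.* suc N) (+ suc N - k) * (k ^ 2 - (+ suc N) ^ 2))
    ≡⟨ cong (sgn l * F *_) (C[2N+2,N+1-k][k²-[N+1]²]≡-[2N+2][2N+1]C[2N,N-k] N k) ⟩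
  sgn l * F * (- (A * B) * C (2 ℕ.* N) (+ N - k))
    ≡⟨ regroup (sgn l) F A B (C (2 ℕ.* N) (+ N - k)) ⟩
  - + 1 * sgn l * (F * A * B) * C (2 ℕ.* N) (+ N - k)
    ≡⟨ cong (λ f → - + 1 * sgn l * f * C (2 ℕ.* N) (+ N - k)) (sym falling[2l+2]) ⟩
  sgn (suc l) * falling (+ (2 ℕ.* n)) (2 ℕ.* suc l) * C (2 ℕ.* N) (+ N - k) ∎
  where
  P F A B : ℤ
  P = Newton.basis (node (+ n)) l (k ^ 2)
  F = falling (+ (2 ℕ.* n)) (2 ℕ.* l)
  A = + suc (suc (2 ℕ.* N))
  B = + suc (2 ℕ.* N)
  n≡l+1+N : n ≡ l ℕ.+ suc N
  n≡l+1+N = trans n≡1+l+N (sym (ℕ.+-suc l N))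
  n-l≡1+N : + n - + l ≡ + suc N
  n-l≡1+N = trans (cong (λ m → + m - + l) n≡l+1+N) (+[m+n]-+m≡+n l (suc N))
  2n≡2l+2+2N : 2 ℕ.* n ≡ 2 ℕ.* l ℕ.+ suc (suc (2 ℕ.* N))
  2n≡2l+2+2N = trans (cong (2 ℕ.*_) n≡l+1+N) (2[l+1+N]≡2l+2+2N l N)
  falling[2l+2] : falling (+ (2 ℕ.* n)) (2 ℕ.* suc l) ≡ F * A * B
  falling[2l+2] = begin
    falling (+ (2 ℕ.* n)) (2 ℕ.* suc l)
      ≡⟨ cong (falling (+ (2 ℕ.* n))) (ℕ.*-suc 2 l) ⟩
    F * (+ (2 ℕ.* n) - + (2 ℕ.* l)) * (+ (2 ℕ.* n) - + suc (2 ℕ.* l))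
      ≡⟨ cong (λ m → F * (+ m - + (2 ℕ.* l)) * (+ m - + suc (2 ℕ.* l))) 2n≡2l+2+2N ⟩
    F * (+ (2 ℕ.* l ℕ.+ suc (suc (2 ℕ.* N))) - + (2 ℕ.* l))
      * (+ (2 ℕ.* l ℕ.+ suc (suc (2 ℕ.* N))) - + suc (2 ℕ.* l))
      ≡⟨ cong₂ (λ p q → F * p * q) (+[m+n]-+m≡+n (2 ℕ.* l) _)
               (trans (cong (λ m → + m - + suc (2 ℕ.* l)) (ℕ.+-suc (2 ℕ.* l) (suc (2 ℕ.* N))))
                      (+[m+n]-+m≡+n (suc (2 ℕ.* l)) _)) ⟩
    F * A * B ∎
  regroup : ∀ s f a b x → s * f * (- (a * b) * x) ≡ - + 1 * s * (f * a * b) * x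
  regroup = solve-∀

alternatingTerm : ℕ → ℕ → ℕ → ℤ
alternatingTerm n l k =
  sgn (k ℕ.∸ 1) * + k * (C (2 ℕ.* n) (+ n - + k) * Newton.basis (node (+ n)) l ((+ k) ^ 2))

moment : ℕ → ℕ → ℤ
moment n l =
  sgn l * falling (+ (2 ℕ.* n)) (2 ℕ.* l) * binom (+ (2 ℕ.* n) - + (2 ℕ.* l) - + 2) (+ n - + l - + 1)

alternating-moment-< : ∀ {n l} → l ℕ.< n →
  sumFromTo 0 n (alternatingTerm n l) ≡ moment n l
alternating-moment-< {n} {l} l<n = begin
  sumFromTo 0 n (alternatingTerm n l)
    ≡⟨ sum-cong n (λ k _ → term≡ k) ⟩
  sumFromTo 0 n (λ k → SF * t k)
    ≡⟨ sym (*-distribˡ-sum n SF t) ⟩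
  SF * sumFromTo 0 n t
    ≡⟨ cong (SF *_) (alternating-sum-kC M n M<n) ⟩
  SF * C (2 ℕ.* M) (+ M)
    ≡⟨ cong (SF *_) (sym (binom≡C (2 ℕ.* M) (+ M))) ⟩
  SF * binom (+ (2 ℕ.* M)) (+ M)
    ≡⟨ cong₂ (λ x j → SF * binom x j) (sym 2n-2l-2≡2M) (sym n-l-1≡M) ⟩
  SF * binom (+ (2 ℕ.* n) - + (2 ℕ.* l) - + 2) (+ n - + l - + 1) ∎
  where
  M : ℕ
  M = n ℕ.∸ suc l
  SF : ℤ
  SF = sgn l * falling (+ (2 ℕ.* n)) (2 ℕ.* l)
  t : ℕ → ℤ
  t k = sgn (k ℕ.∸ 1) * + k * C (2 ℕ.* suc M) (+ suc M - + k)
  n≡l+1+M : n ≡ l ℕ.+ suc M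
  n≡l+1+M = trans (sym (ℕ.m+[n∸m]≡n l<n)) (sym (ℕ.+-suc l M))
  M<n : M ℕ.< n
  M<n = subst (M ℕ.<_) (sym n≡l+1+M) (ℕ.m≤n+m (suc M) l)
  term≡ : ∀ k → alternatingTerm n l k ≡ SF * t k
  term≡ k =
    trans (cong (sgn (k ℕ.∸ 1) * + k *_)
                (C[2n,n-k]*basis≡sgn*falling*C[2N,N-k] l (suc M) (+ k) n≡l+1+M))
          (regroup (sgn (k ℕ.∸ 1)) (+ k) SF (C (2 ℕ.* suc M) (+ suc M - + k)))
    where
    regroup : ∀ s k a c → s * k * (a * c) ≡ a * (s * k * c)
    regroup = solve-∀
  2n-2l-2≡2M : + (2 ℕ.* n) - + (2 ℕ.* l) - + 2 ≡ + (2 ℕ.* M)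
  2n-2l-2≡2M =
    trans (cong (λ m → + m - + (2 ℕ.* l) - + 2)
                (trans (cong (2 ℕ.*_) n≡l+1+M) (2[l+1+N]≡2l+2+2N l M)))
          (trans (cong (_- + 2) (+[m+n]-+m≡+n (2 ℕ.* l) _)) (+[m+n]-+m≡+n 2 (2 ℕ.* M)))
  n-l-1≡M : + n - + l - + 1 ≡ + M
  n-l-1≡M = trans (cong (λ m → + m - + l - + 1) n≡l+1+M)
                  (trans (cong (_- + 1) (+[m+n]-+m≡+n l (suc M))) (+[m+n]-+m≡+n 1 M))

alternating-moment-≥ : ∀ {n l} → n ℕ.≤ l →
  sumFromTo 0 n (alternatingTerm n l) ≡ moment n l
alternating-moment-≥ {n} {l} n≤l = begin
  sumFromTo 0 n (alternatingTerm n l)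
    ≡⟨ sum-vanishes n term≡0 ⟩
  + 0
    ≡⟨ sym (*-zeroʳ SF) ⟩
  SF * + 0
    ≡⟨ cong (λ j → SF * binom (+ (2 ℕ.* n) - + (2 ℕ.* l) - + 2) j) (sym n-l-1<0) ⟩
  SF * binom (+ (2 ℕ.* n) - + (2 ℕ.* l) - + 2) (+ n - + l - + 1) ∎
  where
  SF : ℤ
  SF = sgn l * falling (+ (2 ℕ.* n)) (2 ℕ.* l)
  n-l-1<0 : + n - + l - + 1 ≡ -[1+ l ℕ.∸ n ]
  n-l-1<0 = trans (shift (+ n) (+ l)) (m<n⇒+m-+n≡-[1+n∸[1+m]] (s≤s n≤l))
    where
    shift : ∀ n l → n - l - + 1 ≡ n - (+ 1 + l)
    shift = solve-∀
  -- For 1 ≤ k ≤ n, k² is the node (n - j)² with j = n - k < l, a root of the basis polynomial.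
  term≡0 : ∀ k → k ℕ.≤ n → alternatingTerm n l k ≡ + 0
  term≡0 zero _ = refl
  term≡0 (suc k) 1+k≤n = begin
    sgn k * + suc k * (C (2 ℕ.* n) (+ n - + suc k) * P)
      ≡⟨ cong (λ p → sgn k * + suc k * (C (2 ℕ.* n) (+ n - + suc k) * p)) P≡0 ⟩
    sgn k * + suc k * (C (2 ℕ.* n) (+ n - + suc k) * + 0)
      ≡⟨ cong (sgn k * + suc k *_) (*-zeroʳ (C (2 ℕ.* n) (+ n - + suc k))) ⟩
    sgn k * + suc k * + 0
      ≡⟨ *-zeroʳ (sgn k * + suc k) ⟩
    + 0 ∎
    where
    j : ℕ
    j = n ℕ.∸ suc k
    P : ℤ
    P = Newton.basis (node (+ n)) l ((+ suc k) ^ 2)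
    n-j≡1+k : + n - + j ≡ + suc k
    n-j≡1+k = trans (cong (λ m → + m - + j) (sym (ℕ.m∸n+n≡m 1+k≤n))) (+[m+n]-+m≡+n j (suc k))
    j<l : j ℕ.< l
    j<l = ℕ.<-≤-trans (ℕ.∸-monoʳ-< (s≤s z≤n) 1+k≤n) n≤l
    P≡0 : P ≡ + 0
    P≡0 = trans (cong (λ x → Newton.basis (node (+ n)) l (x ^ 2)) (sym n-j≡1+k))
                (Newton.basis-node (node (+ n)) j<l)

alternating-moment : ∀ n l →
  sumFromTo 0 n (alternatingTerm n l) ≡ moment n l
alternating-moment n l with l ℕ.<? n
... | yes l<n = alternating-moment-< l<n
... | no l≮n = alternating-moment-≥ (ℕ.≮⇒≥ l≮n)

summand-expansion : ∀ m n k →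
  sgn (k ℕ.∸ 1) * binom (+ (2 ℕ.* n)) (+ n - + k) * (+ k) ^ (1 ℕ.+ 2 ℕ.* m)
    ≡ sumFromTo 0 m (λ l → σ m l (+ n) * alternatingTerm n l k)
summand-expansion m n k = begin
  s * binom (+ (2 ℕ.* n)) (+ n - + k) * (+ k * (+ k) ^ (2 ℕ.* m))
    ≡⟨ cong₂ (λ b p → s * b * (+ k * p)) (binom≡C (2 ℕ.* n) (+ n - + k)) (sym (^-*-assoc (+ k) 2 m)) ⟩
  s * c * (+ k * ((+ k) ^ 2) ^ m)
    ≡⟨ cong (λ p → s * c * (+ k * p)) (Newton.power-expansion (node (+ n)) ((+ k) ^ 2) m) ⟩
  s * c * (+ k * sumFromTo 0 m (λ l → coeff m l * basis l))
    ≡⟨ regroup s c (+ k) _ ⟩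
  s * + k * c * sumFromTo 0 m (λ l → coeff m l * basis l)
    ≡⟨ *-distribˡ-sum m (s * + k * c) _ ⟩
  sumFromTo 0 m (λ l → s * + k * c * (coeff m l * basis l))
    ≡⟨ sum-cong m (λ l l≤m → trans (regroup′ (s * + k) c (coeff m l) (basis l))
                                     (cong (λ h → h * alternatingTerm n l k) (sym (σ≡coeff (+ n) l≤m)))) ⟩
  sumFromTo 0 m (λ l → σ m l (+ n) * alternatingTerm n l k) ∎
  where
  s c : ℤ
  s = sgn (k ℕ.∸ 1)
  c = C (2 ℕ.* n) (+ n - + k)
  coeff : ℕ → ℕ → ℤ
  coeff = Newton.coeff (node (+ n))
  basis : ℕ → ℤ
  basis l = Newton.basis (node (+ n)) l ((+ k) ^ 2)
  regroup : ∀ s c k x → s * c * (k * x) ≡ s * k * c * x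
  regroup = solve-∀
  regroup′ : ∀ sk c h p → sk * c * (h * p) ≡ h * (sk * (c * p))
  regroup′ = solve-∀

theorem8 : (m n : ℕ) → 1 ℕ.≤ m → 1 ℕ.≤ n →
    sumFromTo 1 n (λ k → sgn (k ℕ.∸ 1) * binom (+ (2 ℕ.* n)) (+ n - + k) * (+ k) ^ (1 ℕ.+ 2 ℕ.* m))
      ≡ sumFromTo 0 m (λ ℓ → sgn ℓ * falling (+ (2 ℕ.* n)) (2 ℕ.* ℓ)
          * binom (+ (2 ℕ.* n) - + (2 ℕ.* ℓ) - + 2) (+ n - + ℓ - + 1) * σ m ℓ (+ n))
theorem8 m n _ _ = begin
  sumFromTo 1 n lhs
    ≡⟨ sum-from-1 n lhs (*-zeroʳ (sgn 0 * binom (+ (2 ℕ.* n)) (+ n - + 0))) ⟩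
  sumFromTo 0 n lhs
    ≡⟨ sum-cong n (λ k _ → summand-expansion m n k) ⟩
  sumFromTo 0 n (λ k → sumFromTo 0 m (λ l → σ m l (+ n) * alternatingTerm n l k))
    ≡⟨ sum-comm n m (λ k l → σ m l (+ n) * alternatingTerm n l k) ⟩
  sumFromTo 0 m (λ l → sumFromTo 0 n (λ k → σ m l (+ n) * alternatingTerm n l k))
    ≡⟨ sum-cong m (λ l _ → weighted-moment l) ⟩
  sumFromTo 0 m (λ ℓ → sgn ℓ * falling (+ (2 ℕ.* n)) (2 ℕ.* ℓ)
    * binom (+ (2 ℕ.* n) - + (2 ℕ.* ℓ) - + 2) (+ n - + ℓ - + 1) * σ m ℓ (+ n)) ∎
  where
  lhs : ℕ → ℤ
  lhs k = sgn (k ℕ.∸ 1) * binom (+ (2 ℕ.* n)) (+ n - + k) * (+ k) ^ (1 ℕ.+ 2 ℕ.* m)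
  weighted-moment : ∀ l →
    sumFromTo 0 n (λ k → σ m l (+ n) * alternatingTerm n l k) ≡ moment n l * σ m l (+ n)
  weighted-moment l = begin
    sumFromTo 0 n (λ k → σ m l (+ n) * alternatingTerm n l k)
      ≡⟨ sym (*-distribˡ-sum n (σ m l (+ n)) (alternatingTerm n l)) ⟩
    σ m l (+ n) * sumFromTo 0 n (alternatingTerm n l)
      ≡⟨ cong (σ m l (+ n) *_) (alternating-moment n l) ⟩
    σ m l (+ n) * moment n l
      ≡⟨ *-comm (σ m l (+ n)) (moment n l) ⟩
    moment n l * σ m l (+ n) ∎
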